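{- Let $w\in S_n$ be vexillary. Suppose $(i,j_1),(i,j_2)\in D(w)$ are not linked and $(i,j_1)\prec_R(i,j_2)$. Then $j_1>j_2$.
   Context: $w$ is vexillary if it avoids the pattern $2143$. Rothe diagram: $D(w)=\{(i,j)\in[n]\times[n]:i<w^{ -1}(j),\ j<w(i)\}$ ($i$ = row, $j$ = column), with rank $r(i,j)=|\{k<i:w(k)<j\}|$. Two squares $(i,j),(i',j')\in D(w)$ are linked if $i-i'=r(i,j)-r(i',j')$. For $(i,j)\in D(w)$ let $b(i,j)=|\{i'>i:(i',j)\in D(w)\}|$. The right bubbling order $\prec_R$ on $D(w)$: $(i,j)\prec_R(i',j')$ iff $i>i'$, or $i=i'$ and $b(i,j)<b(i',j')$, or $i=i'$, $b(i,j)=b(i',j')$ and $j>j'$. -}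

module Defs where

open import Data.Nat as ℕ using (ℕ)
open import Data.Integer as ℤ using (ℤ; +_; _-_)
open import Data.Fin using (Fin; _<_; toℕ)
open import Data.Fin.Properties using (_<?_)
open import Data.Fin.Permutation using (Permutation′; _⟨$⟩ʳ_; _⟨$⟩ˡ_)
open import Data.List using (List; length; filter; allFin)
open import Data.Product using (_×_; _,_)
open import Data.Sum using (_⊎_)
open import Data.Empty using (⊥)
open import Relation.Binary.PropositionalEquality using (_≡_)
open import Relation.Nullary.Decidable using (_×-dec_)

-- Permutations w ∈ S_n are bijections Fin n ↔ Fin n (positions/values 0-indexed;
-- all notions below only depend on the relative order, so this is harmless).

Vexillary : {n : ℕ} → Permutation′ n → Set
Vexillary {n} w =
  (a b c d : Fin n) → a < b → b < c → c < d →
  w ⟨$⟩ʳ b < w ⟨$⟩ʳ a → w ⟨$⟩ʳ a < w ⟨$⟩ʳ d → w ⟨$⟩ʳ d < w ⟨$⟩ʳ c → ⊥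

InD : {n : ℕ} → Permutation′ n → Fin n → Fin n → Set
InD w i j = (i < w ⟨$⟩ˡ j) × (j < w ⟨$⟩ʳ i)

rank : {n : ℕ} → Permutation′ n → Fin n → Fin n → ℕ
rank {n} w i j = length (filter (λ k → (k <? i) ×-dec (w ⟨$⟩ʳ k <? j)) (allFin n))

Linked : {n : ℕ} → Permutation′ n → (Fin n × Fin n) → (Fin n × Fin n) → Set
Linked w (i , j) (i' , j') =
  (+ toℕ i) - (+ toℕ i') ≡ (+ rank w i j) - (+ rank w i' j')

bval : {n : ℕ} → Permutation′ n → Fin n → Fin n → ℕ
bval {n} w i j =
  length (filter (λ i' → (i <? i') ×-dec ((i' <? w ⟨$⟩ˡ j) ×-dec (j <? w ⟨$⟩ʳ i'))) (allFin n))

_≺R[_]_ : {n : ℕ} → (Fin n × Fin n) → Permutation′ n → (Fin n × Fin n) → Set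
(i , j) ≺R[ w ] (i' , j') =
  (i' < i)
  ⊎ ((i ≡ i') × (bval w i j ℕ.< bval w i' j'))
  ⊎ ((i ≡ i') × (bval w i j ≡ bval w i' j') × (j' < j))

-- Squares (i, j₁), (i, j₂) of one row are linked exactly when r(i, j₁) = r(i, j₂).
-- So if j₁ < j₂ and they are not linked, some k < i has j₁ < w(k) < j₂.  For a square
-- (i′, j₂) of D(w), having w⁻¹(j₁) < i′ would make k, w⁻¹(j₁), i′, w⁻¹(j₂) a 2143;
-- hence every square of column j₂ below row i has a partner in column j₁, so
-- b(i, j₂) ≤ b(i, j₁), and then (i, j₁) ≺R (i, j₂) forces j₂ < j₁ after all.
module Submission where

open import Defs
open import Data.Nat using (ℕ)
open import Data.Fin using (Fin; _<_; toℕ)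
open import Data.Fin.Permutation using (Permutation′)
open import Data.Product using (_,_)
open import Relation.Nullary using (¬_)

open import Level using (Level)
import Data.Nat as ℕ
open import Data.Nat.Properties using (<⇒≱)
open import Data.Integer using (+_; _-_)
open import Data.Integer.Properties using (i≡j⇒i-j≡0)
open import Data.Fin.Properties using (<-cmp; <-trans; <-irrefl; _<?_)
open import Data.Fin.Permutation using (_⟨$⟩ʳ_; _⟨$⟩ˡ_; inverseˡ; inverseʳ)
open import Data.List using ([]; _∷_; length; filter; allFin)
open import Data.List.Relation.Binary.Sublist.Propositional using (⊆-refl)
open import Data.List.Relation.Binary.Sublist.Propositional.Properties
  using (filter⁺; length-mono-≤)
open import Data.Product using (_×_; ∃-syntax; proj₁)
open import Data.Sum using (inj₁; inj₂)
open import Data.Empty using (⊥; ⊥-elim)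
open import Function using (_∘_)
open import Relation.Nullary using (yes; no)
open import Relation.Nullary.Decidable using (_×-dec_)
open import Relation.Unary using (Pred; Decidable; _⊆_)
open import Relation.Binary using (tri<; tri≈; tri>)
open import Relation.Binary.PropositionalEquality
  using (_≡_; _≢_; refl; sym; trans; cong; subst)

module _ {a p q : Level} {A : Set a} {P : Pred A p} {Q : Pred A q}
         (P? : Decidable P) (Q? : Decidable Q) where

  length-filter-mono : P ⊆ Q → ∀ xs → length (filter P? xs) ℕ.≤ length (filter Q? xs)
  length-filter-mono P⊆Q xs = length-mono-≤ (filter⁺ P? Q? (λ { refl → P⊆Q }) (⊆-refl {x = xs}))

  length-filter-≢⇒∃ : P ⊆ Q → ∀ xs → length (filter P? xs) ≢ length (filter Q? xs) →
                      ∃[ x ] Q x × ¬ P x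
  length-filter-≢⇒∃ P⊆Q []       ≢ = ⊥-elim (≢ refl)
  length-filter-≢⇒∃ P⊆Q (x ∷ xs) ≢ with P? x | Q? x
  ... | yes _  | yes _  = length-filter-≢⇒∃ P⊆Q xs (≢ ∘ cong ℕ.suc)
  ... | yes Px | no ¬Qx = ⊥-elim (¬Qx (P⊆Q Px))
  ... | no ¬Px | yes Qx = x , Qx , ¬Px
  ... | no _   | no _   = length-filter-≢⇒∃ P⊆Q xs ≢

module _ {n : ℕ} (w : Permutation′ n) where

  ⟨$⟩ʳ≡⇒≡⟨$⟩ˡ : ∀ {k j} → w ⟨$⟩ʳ k ≡ j → k ≡ w ⟨$⟩ˡ j
  ⟨$⟩ʳ≡⇒≡⟨$⟩ˡ w[k]≡j = trans (sym (inverseˡ w)) (cong (w ⟨$⟩ˡ_) w[k]≡j)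

  vexillary-no-2143-at-values : Vexillary w → ∀ {a c x y} →
    a < w ⟨$⟩ˡ x → w ⟨$⟩ˡ x < c → c < w ⟨$⟩ˡ y →
    x < w ⟨$⟩ʳ a → w ⟨$⟩ʳ a < y → y < w ⟨$⟩ʳ c → ⊥
  vexillary-no-2143-at-values vex a<b b<c c<d x<w[a] w[a]<y y<w[c] =
    vex _ _ _ _ a<b b<c c<d
      (subst (_< _) (sym (inverseʳ w)) x<w[a])
      (subst (_ <_) (sym (inverseʳ w)) w[a]<y)
      (subst (_< _) (sym (inverseʳ w)) y<w[c])

  same-row-linked : ∀ {i j₁ j₂} → rank w i j₁ ≡ rank w i j₂ → Linked w (i , j₁) (i , j₂)
  same-row-linked {i} r≡r = trans (i≡j⇒i-j≡0 {+ toℕ i} refl) (sym (i≡j⇒i-j≡0 (cong +_ r≡r)))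

  rank-≢⇒∃-between : ∀ {i j₁ j₂} → InD w i j₁ → j₁ < j₂ → rank w i j₁ ≢ rank w i j₂ →
                     ∃[ k ] k < i × j₁ < w ⟨$⟩ʳ k × w ⟨$⟩ʳ k < j₂
  rank-≢⇒∃-between {i} {j₁} {j₂} (i<w⁻¹[j₁] , _) j₁<j₂ r≢r
    with length-filter-≢⇒∃ (λ k → (k <? i) ×-dec (w ⟨$⟩ʳ k <? j₁))
                           (λ k → (k <? i) ×-dec (w ⟨$⟩ʳ k <? j₂))
                           (λ (k<i , w[k]<j₁) → k<i , <-trans w[k]<j₁ j₁<j₂) (allFin n) r≢r
  ... | k , (k<i , w[k]<j₂) , ¬[k<i×w[k]<j₁] with <-cmp (w ⟨$⟩ʳ k) j₁
  ...   | tri< w[k]<j₁ _ _ = ⊥-elim (¬[k<i×w[k]<j₁] (k<i , w[k]<j₁))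
  ...   | tri≈ _ w[k]≡j₁ _ =
            ⊥-elim (<-irrefl (⟨$⟩ʳ≡⇒≡⟨$⟩ˡ w[k]≡j₁) (<-trans k<i i<w⁻¹[j₁]))
  ...   | tri> _ _ j₁<w[k] = k , k<i , j₁<w[k] , w[k]<j₂

  vexillary-InD-shift : Vexillary w → ∀ {k i′ j₁ j₂} →
    k < w ⟨$⟩ˡ j₁ → j₁ < w ⟨$⟩ʳ k → w ⟨$⟩ʳ k < j₂ → InD w i′ j₂ → InD w i′ j₁
  vexillary-InD-shift vex {k} {i′} {j₁} {j₂} k<w⁻¹[j₁] j₁<w[k] w[k]<j₂ (i′<w⁻¹[j₂] , j₂<w[i′]) =
    i′<w⁻¹[j₁] , j₁<w[i′]
    where
    j₁<w[i′] : j₁ < w ⟨$⟩ʳ i′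
    j₁<w[i′] = <-trans j₁<w[k] (<-trans w[k]<j₂ j₂<w[i′])
    i′<w⁻¹[j₁] : i′ < w ⟨$⟩ˡ j₁
    i′<w⁻¹[j₁] with <-cmp i′ (w ⟨$⟩ˡ j₁)
    ... | tri< i′<w⁻¹[j₁] _ _ = i′<w⁻¹[j₁]
    ... | tri≈ _ i′≡w⁻¹[j₁] _ =
            ⊥-elim (<-irrefl (sym (trans (cong (w ⟨$⟩ʳ_) i′≡w⁻¹[j₁]) (inverseʳ w))) j₁<w[i′])
    ... | tri> _ _ w⁻¹[j₁]<i′ =
            ⊥-elim (vexillary-no-2143-at-values vex k<w⁻¹[j₁] w⁻¹[j₁]<i′ i′<w⁻¹[j₂]
                      j₁<w[k] w[k]<j₂ j₂<w[i′])

  bval-mono : ∀ {i j₁ j₂} → (∀ {i′} → InD w i′ j₁ → InD w i′ j₂) → bval w i j₁ ℕ.≤ bval w i j₂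
  bval-mono {i} {j₁} {j₂} D₁⊆D₂ = length-filter-mono
    (λ i′ → (i <? i′) ×-dec ((i′ <? w ⟨$⟩ˡ j₁) ×-dec (j₁ <? w ⟨$⟩ʳ i′)))
    (λ i′ → (i <? i′) ×-dec ((i′ <? w ⟨$⟩ˡ j₂) ×-dec (j₂ <? w ⟨$⟩ʳ i′)))
    (λ (i<i′ , i′j₁∈D) → i<i′ , D₁⊆D₂ i′j₁∈D) (allFin n)

  ≺R-same-row : ∀ {i j₁ j₂} → (i , j₁) ≺R[ w ] (i , j₂) → bval w i j₂ ℕ.≤ bval w i j₁ → j₂ < j₁
  ≺R-same-row (inj₁ i<i)                    _     = ⊥-elim (<-irrefl refl i<i)
  ≺R-same-row (inj₂ (inj₁ (_ , b₁<b₂)))     b₂≤b₁ = ⊥-elim (<⇒≱ b₁<b₂ b₂≤b₁)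
  ≺R-same-row (inj₂ (inj₂ (_ , _ , j₂<j₁))) _     = j₂<j₁

lemma4p2 : (n : ℕ) (w : Permutation′ n) → Vexillary w →
    (i j₁ j₂ : Fin n) → InD w i j₁ → InD w i j₂ →
    ¬ Linked w (i , j₁) (i , j₂) →
    (i , j₁) ≺R[ w ] (i , j₂) →
    j₂ < j₁
lemma4p2 n w vex i j₁ j₂ ij₁∈D _ ¬linked ≺ with <-cmp j₁ j₂
... | tri> _ _ j₂<j₁ = j₂<j₁
... | tri≈ _ refl _  = ⊥-elim (¬linked (same-row-linked w refl))
... | tri< j₁<j₂ _ _
  with k , k<i , j₁<w[k] , w[k]<j₂ ← rank-≢⇒∃-between w ij₁∈D j₁<j₂ (¬linked ∘ same-row-linked w) =
  ≺R-same-row w ≺ (bval-mono w (vexillary-InD-shift w vex k<w⁻¹[j₁] j₁<w[k] w[k]<j₂))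
  where
  k<w⁻¹[j₁] : k < w ⟨$⟩ˡ j₁
  k<w⁻¹[j₁] = <-trans k<i (proj₁ ij₁∈D)
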